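{- Let $G$ be a graph and let $P$ be a suspended path of $G$ of length $\ell\ge 1$. Let $G'$ be the graph obtained from $G$ by removing the internal vertices of $P$, and let $k\coloneqq\lceil \ell/3\rceil$. Then $\operatorname{fdom}(G)\ge \min\left\{\frac{3k-1}{k},\operatorname{fdom}(G')\right\}$.
   Context: A suspended path of length $\ell$ in $G$ is a path with $\ell$ edges whose two endpoints are distinct and have degree at least $3$ in $G$ and whose inner vertices have degree exactly $2$ in $G$. For integers $0<q\le p$, a dominating $(p:q)$-colouring of a graph $G$ is a map $\phi\colon V(G)\to\binom{[p]}{q}$ with $\bigcup_{u\in N[v]}\phi(u)=[p]$ for every vertex $v$ ($N[v]$ the closed neighbourhood); $\operatorname{fdom}(G)$ is the maximum of $p/q$ over such colourings. -}

module Defs where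

open import Data.Bool using (Bool; true; false; T)
open import Data.Nat using (ℕ; zero; suc; _+_; _*_; _∸_; _≤_; _<_; _≥_)
open import Data.Nat.DivMod using (_/_)
open import Data.Fin using (Fin; zero; suc; inject₁; toℕ)
open import Data.Fin.Subset using (Subset; _∈_; ∣_∣)
open import Data.List using (List; length; filter)
open import Data.List.Base using (allFin)
open import Data.Integer using (+_)
open import Data.Rational using (ℚ; 0ℚ) renaming (_/_ to _/ℚ_)
import Data.Rational as ℚ
open import Data.Product using (Σ; _×_; _,_; ∃)
open import Data.Sum using (_⊎_)
open import Relation.Binary.PropositionalEquality using (_≡_; _≢_)
open import Relation.Nullary using (¬_)
open import Function.Definitions using (Injective)

record Graph : Set where
  field
    n     : ℕ
    adj   : Fin n → Fin n → Bool
    sym   : ∀ u v → adj u v ≡ adj v u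
    irrefl : ∀ v → adj v v ≡ false
open Graph public

Adj : (G : Graph) → Fin (n G) → Fin (n G) → Set
Adj G u v = T (adj G u v)

degree : (G : Graph) → Fin (n G) → ℕ
degree G v = length (filter (λ u → Data.Bool._≟_ (adj G v u) true) (allFin (n G)))

record SuspendedPath (G : Graph) (ℓ : ℕ) : Set where
  field
    x       : Fin (suc ℓ) → Fin (n G)
    inj     : Injective _≡_ _≡_ x
    edges   : (i : Fin ℓ) → Adj G (x (inject₁ i)) (x (suc i))
    deg-start : degree G (x zero) ≥ 3
    deg-end   : degree G (x (Data.Fin.fromℕ ℓ)) ≥ 3
    deg-inner : (i : Fin (suc ℓ)) → 0 < toℕ i → toℕ i < ℓ → degree G (x i) ≡ 2
open SuspendedPath public

Inner : {G : Graph} {ℓ : ℕ} → SuspendedPath G ℓ → Fin (n G) → Set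
Inner {ℓ = ℓ} P v = Σ (Fin (suc ℓ)) λ i → (0 < toℕ i) × (toℕ i < ℓ) × (x P i ≡ v)

-- p / q as a rational (q = 0 never used: colourings have q ≥ 1)
frac : ℕ → ℕ → ℚ
frac p zero    = 0ℚ
frac p (suc q) = (+ p) /ℚ (suc q)

-- A dominating (p:q)-colouring of the induced subgraph G[S], where the
-- vertex set S ⊆ V(G) is given by a predicate. Colours of vertices outside S
-- are irrelevant.
record DomColouringOn (G : Graph) (S : Fin (n G) → Set) (p q : ℕ) : Set where
  field
    q-pos : 0 < q
    q≤p   : q ≤ p
    φ     : Fin (n G) → Subset p
    size  : ∀ v → S v → ∣ φ v ∣ ≡ q
    dom   : ∀ v → S v → (c : Fin p) →
            ∃ λ u → S u × (u ≡ v ⊎ Adj G u v) × c ∈ φ u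

record IsFdomOn (G : Graph) (S : Fin (n G) → Set) (r : ℚ) : Set where
  field
    attained : Σ ℕ λ p → Σ ℕ λ q → DomColouringOn G S p q × frac p q ≡ r
    upper    : ∀ p q → DomColouringOn G S p q → frac p q ℚ.≤ r

Everything : (G : Graph) → Fin (n G) → Set
Everything G v = v ≡ v

IsFdom : Graph → ℚ → Set
IsFdom G r = IsFdomOn G (Everything G) r

ceil3 : ℕ → ℕ
ceil3 ℓ = (ℓ + 2) / 3

-- Let k = ⌈ℓ/3⌉ and take an optimal dominating (p:q)-colouring of G′. If p/q ≤ (3k−1)/k it
-- extends to G: the ends of P keep their colour sets A and B, and the path vertices x j receive
-- q-sets M j such that any three consecutive ones cover all colours. The M j are windows of q
-- cyclically consecutive colours in a cyclic listing of the colours that begins with A∖B, A∩B,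
-- B∖A, so the window at 0 lies in A and the window at |A∖B| + (any multiple of the period) lies
-- in B; the windows start at the evenly spaced points ⌊jT/N⌋ and sweep k times round the
-- cycle. When 3 ∤ ℓ the sweep has 2k−1 steps and every third vertex gets instead a fixed set W
-- of at most q colours outside A ∪ B. If p/q > (3k−1)/k, pulling colours back along
-- y ↦ y mod p first turns the colouring into a dominating ((3k−1)q : kq)-colouring of G′, which
-- then extends.
module Submission where

open import Data.Bool using (T)
open import Data.Empty using (⊥-elim)
open import Data.Fin as Fin using (Fin; toℕ; fromℕ; fromℕ<; inject₁)
open import Data.Fin.Properties using (any?; toℕ-fromℕ; toℕ-fromℕ<; toℕ-inject₁; toℕ-injective; toℕ≤pred[n]; toℕ<n)
open import Data.Fin.Subset using (Subset; inside; outside; _∈_; ∣_∣; _∪_; _∩_; ∁; ⁅_⁆; ⊥; _⊆_)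
open import Data.Fin.Subset.Properties using (∣⊥∣≡0; ∣⁅x⁆∣≡1; ∣p∣≤n; x∈⁅x⁆; x∈⁅y⁆⇒x≡y; ∉⊥; x∈p∪q⁺; x∈p∪q⁻; _∈?_; x∈p∩q⁺; x∈p∩q⁻; x∉p⇒x∈∁p)
open import Data.Integer as ℤ using ()
import Data.Integer.Properties as ℤ
open import Data.List using (List; []; _∷_; _++_; length; map; applyUpTo; concatMap; take; drop)
open import Data.List.Properties using (length-map; length-applyUpTo; length-++; ++-assoc; length-take; length-drop; take++drop≡id)
open import Data.List.Membership.Propositional using () renaming (_∈_ to _∈ₗ_)
open import Data.List.Membership.Propositional.Properties using (∈-map⁺; ∈-map⁻; ∈-applyUpTo⁺; ∈-applyUpTo⁻; ∈-++⁺ˡ; ∈-++⁺ʳ; ∈-++⁻; ∈-concatMap⁺)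
open import Data.List.Relation.Unary.Any as Any using (here; there)
open import Data.Nat using (ℕ; zero; suc; pred; _+_; _*_; _∸_; _≤_; _<_; z≤n; s≤s; _≤?_; _<?_; _≟_; NonZero; >-nonZero; >-nonZero⁻¹)
open import Data.Nat.DivMod using (_%_; _/_; _mod_; m%n<n; m≡m%n+[m/n]*n; m<n⇒m%n≡m; [m+n]%n≡m%n; [m+kn]%n≡m%n; 0/n≡0; m*n/n≡m; +-distrib-/-∣ʳ; /-monoˡ-≤; m<n⇒m/n≡0; m<n*o⇒m/o<n; m≥n⇒m/n>0)
open import Data.Nat.Divisibility using (divides)
open import Data.Nat.Properties
open import Data.Nat.Tactic.RingSolver using (solve; solve-∀)
open import Data.Product using (∃; _×_; _,_; proj₁; proj₂)
open import Data.Rational using (ℚ; _⊓_) renaming (_≤_ to _≤ℚ_)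
import Data.Rational.Properties as ℚ
import Data.Rational.Unnormalised as ℚᵘ
open import Data.Sum as ⊎ using (_⊎_; inj₁; inj₂)
open import Relation.Binary.PropositionalEquality using (_≡_; refl; sym; trans; cong; cong₂; subst; module ≡-Reasoning)
open import Relation.Nullary using (¬_; Dec; yes; no)
open import Relation.Nullary.Decidable using (_×-dec_)

open import Defs hiding (sym)

private
  variable
    p : ℕ

-- Vec's constructors are opened only in this block: with both _∷_ in scope the ring solver's
-- variable lists below would be ambiguous.
module _ where

  open import Data.Vec using ([]; _∷_; here; there)

  ∣p∪q∣≤∣p∣+∣q∣ : (X Y : Subset p) → ∣ X ∪ Y ∣ ≤ ∣ X ∣ + ∣ Y ∣
  ∣p∪q∣≤∣p∣+∣q∣ []            []            = z≤n
  ∣p∪q∣≤∣p∣+∣q∣ (inside  ∷ X) (inside  ∷ Y) = s≤s (≤-trans (m≤n⇒m≤1+n (∣p∪q∣≤∣p∣+∣q∣ X Y)) (≤-reflexive (sym (+-suc _ _))))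
  ∣p∪q∣≤∣p∣+∣q∣ (inside  ∷ X) (outside ∷ Y) = s≤s (∣p∪q∣≤∣p∣+∣q∣ X Y)
  ∣p∪q∣≤∣p∣+∣q∣ (outside ∷ X) (inside  ∷ Y) = ≤-trans (s≤s (∣p∪q∣≤∣p∣+∣q∣ X Y)) (≤-reflexive (sym (+-suc _ _)))
  ∣p∪q∣≤∣p∣+∣q∣ (outside ∷ X) (outside ∷ Y) = ∣p∪q∣≤∣p∣+∣q∣ X Y

  fromList : List (Fin p) → Subset p
  fromList []       = ⊥
  fromList (x ∷ xs) = ⁅ x ⁆ ∪ fromList xs

  ∣fromList∣≤length : (xs : List (Fin p)) → ∣ fromList xs ∣ ≤ length xs
  ∣fromList∣≤length {p} []       = ≤-reflexive (∣⊥∣≡0 p)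
  ∣fromList∣≤length (x ∷ xs) = begin
    ∣ ⁅ x ⁆ ∪ fromList xs ∣         ≤⟨ ∣p∪q∣≤∣p∣+∣q∣ ⁅ x ⁆ (fromList xs) ⟩
    ∣ ⁅ x ⁆ ∣ + ∣ fromList xs ∣     ≡⟨ cong (_+ ∣ fromList xs ∣) (∣⁅x⁆∣≡1 x) ⟩
    suc ∣ fromList xs ∣            ≤⟨ s≤s (∣fromList∣≤length xs) ⟩
    suc (length xs)                ∎
    where open ≤-Reasoning

  ∈-fromList⁺ : {x : Fin p} {xs : List (Fin p)} → x ∈ₗ xs → x ∈ fromList xs
  ∈-fromList⁺ (here refl) = x∈p∪q⁺ (inj₁ (x∈⁅x⁆ _))
  ∈-fromList⁺ (there x∈xs) = x∈p∪q⁺ (inj₂ (∈-fromList⁺ x∈xs))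

  ∈-fromList⁻ : {x : Fin p} (xs : List (Fin p)) → x ∈ fromList xs → x ∈ₗ xs
  ∈-fromList⁻ []       x∈⊥ = ⊥-elim (∉⊥ x∈⊥)
  ∈-fromList⁻ (y ∷ xs) x∈ with x∈p∪q⁻ ⁅ y ⁆ (fromList xs) x∈
  ... | inj₁ x∈⁅y⁆  = here (x∈⁅y⁆⇒x≡y y x∈⁅y⁆)
  ... | inj₂ x∈xs   = there (∈-fromList⁻ xs x∈xs)

  elements : Subset p → List (Fin p)
  elements []            = []
  elements (inside  ∷ X) = Fin.zero ∷ map Fin.suc (elements X)
  elements (outside ∷ X) = map Fin.suc (elements X)

  length-elements : (X : Subset p) → length (elements X) ≡ ∣ X ∣
  length-elements []            = refl
  length-elements (inside  ∷ X) = cong suc (trans (length-map Fin.suc (elements X)) (length-elements X))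
  length-elements (outside ∷ X) = trans (length-map Fin.suc (elements X)) (length-elements X)

  ∈-elements⁺ : {x : Fin p} (X : Subset p) → x ∈ X → x ∈ₗ elements X
  ∈-elements⁺ (inside  ∷ X) here      = here refl
  ∈-elements⁺ (inside  ∷ X) (there x∈X) = there (∈-map⁺ Fin.suc (∈-elements⁺ X x∈X))
  ∈-elements⁺ (outside ∷ X) (there x∈X) = ∈-map⁺ Fin.suc (∈-elements⁺ X x∈X)

  ∈-elements⁻ : {x : Fin p} (X : Subset p) → x ∈ₗ elements X → x ∈ X
  ∈-elements⁻ (inside  ∷ X) (here refl) = here
  ∈-elements⁻ (inside  ∷ X) (there x∈) with ∈-map⁻ Fin.suc x∈
  ... | _ , y∈ , refl = there (∈-elements⁻ X y∈)
  ∈-elements⁻ (outside ∷ X) x∈ with ∈-map⁻ Fin.suc x∈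
  ... | _ , y∈ , refl = there (∈-elements⁻ X y∈)

  enlarge : Subset p → ℕ → Subset p
  enlarge []            _       = []
  enlarge (inside  ∷ X) q       = inside ∷ enlarge X (pred q)
  enlarge (outside ∷ X) zero    = outside ∷ X
  enlarge (outside ∷ X) (suc q) with ∣ X ∣ ≤? q
  ... | yes _ = inside ∷ enlarge X q
  ... | no  _ = outside ∷ X

  ⊆-enlarge : (X : Subset p) (q : ℕ) → X ⊆ enlarge X q
  ⊆-enlarge (inside  ∷ X) q       here        = here
  ⊆-enlarge (inside  ∷ X) q       (there x∈X) = there (⊆-enlarge X (pred q) x∈X)
  ⊆-enlarge (outside ∷ X) zero    x∈X         = x∈X
  ⊆-enlarge (outside ∷ X) (suc q) (there x∈X) with ∣ X ∣ ≤? q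
  ... | yes _ = there (⊆-enlarge X q x∈X)
  ... | no  _ = there x∈X

  ∣enlarge∣≡ : (X : Subset p) {q : ℕ} → ∣ X ∣ ≤ q → q ≤ p → ∣ enlarge X q ∣ ≡ q
  ∣enlarge∣≡ []            {zero}  _             _         = refl
  ∣enlarge∣≡ (inside  ∷ X) {suc q} (s≤s ∣X∣≤q)   (s≤s q≤p) = cong suc (∣enlarge∣≡ X ∣X∣≤q q≤p)
  ∣enlarge∣≡ (outside ∷ X) {zero}  ∣X∣≤0         _         = n≤0⇒n≡0 ∣X∣≤0
  ∣enlarge∣≡ (outside ∷ X) {suc q} ∣X∣≤1+q       (s≤s q≤p) with ∣ X ∣ ≤? q
  ... | yes ∣X∣≤q = cong suc (∣enlarge∣≡ X ∣X∣≤q q≤p)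
  ... | no  ∣X∣≰q = ≤-antisym ∣X∣≤1+q (≰⇒> ∣X∣≰q)

  ∣p∩∁q∣+∣p∩q∣≡∣p∣ : (X Y : Subset p) → ∣ X ∩ ∁ Y ∣ + ∣ X ∩ Y ∣ ≡ ∣ X ∣
  ∣p∩∁q∣+∣p∩q∣≡∣p∣ []            []            = refl
  ∣p∩∁q∣+∣p∩q∣≡∣p∣ (inside  ∷ X) (inside  ∷ Y) = trans (+-suc _ _) (cong suc (∣p∩∁q∣+∣p∩q∣≡∣p∣ X Y))
  ∣p∩∁q∣+∣p∩q∣≡∣p∣ (inside  ∷ X) (outside ∷ Y) = cong suc (∣p∩∁q∣+∣p∩q∣≡∣p∣ X Y)
  ∣p∩∁q∣+∣p∩q∣≡∣p∣ (outside ∷ X) (_       ∷ Y) = ∣p∩∁q∣+∣p∩q∣≡∣p∣ X Y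

  ∣p∩q∣+∣∁p∩q∣≡∣q∣ : (X Y : Subset p) → ∣ X ∩ Y ∣ + ∣ ∁ X ∩ Y ∣ ≡ ∣ Y ∣
  ∣p∩q∣+∣∁p∩q∣≡∣q∣ []            []            = refl
  ∣p∩q∣+∣∁p∩q∣≡∣q∣ (inside  ∷ X) (inside  ∷ Y) = cong suc (∣p∩q∣+∣∁p∩q∣≡∣q∣ X Y)
  ∣p∩q∣+∣∁p∩q∣≡∣q∣ (outside ∷ X) (inside  ∷ Y) = trans (+-suc _ _) (cong suc (∣p∩q∣+∣∁p∩q∣≡∣q∣ X Y))
  ∣p∩q∣+∣∁p∩q∣≡∣q∣ (inside  ∷ X) (outside ∷ Y) = ∣p∩q∣+∣∁p∩q∣≡∣q∣ X Y
  ∣p∩q∣+∣∁p∩q∣≡∣q∣ (outside ∷ X) (outside ∷ Y) = ∣p∩q∣+∣∁p∩q∣≡∣q∣ X Y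

  ∣p∩∁q∣+∣p∩q∣+∣∁p∩q∣+∣∁p∩∁q∣≡n : (X Y : Subset p) →
    ∣ X ∩ ∁ Y ∣ + (∣ X ∩ Y ∣ + (∣ ∁ X ∩ Y ∣ + ∣ ∁ X ∩ ∁ Y ∣)) ≡ p
  ∣p∩∁q∣+∣p∩q∣+∣∁p∩q∣+∣∁p∩∁q∣≡n [] [] = refl
  ∣p∩∁q∣+∣p∩q∣+∣∁p∩q∣+∣∁p∩∁q∣≡n {suc p} (x ∷ X) (y ∷ Y) =
    trans (lemma x y) (cong suc (∣p∩∁q∣+∣p∩q∣+∣∁p∩q∣+∣∁p∩∁q∣≡n X Y))
    where
    lemma : ∀ x y → ∣ (x ∷ X) ∩ ∁ (y ∷ Y) ∣ + (∣ (x ∷ X) ∩ (y ∷ Y) ∣ + (∣ ∁ (x ∷ X) ∩ (y ∷ Y) ∣ + ∣ ∁ (x ∷ X) ∩ ∁ (y ∷ Y) ∣))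
                  ≡ suc (∣ X ∩ ∁ Y ∣ + (∣ X ∩ Y ∣ + (∣ ∁ X ∩ Y ∣ + ∣ ∁ X ∩ ∁ Y ∣)))
    lemma inside  inside  = +-suc _ _
    lemma inside  outside = refl
    lemma outside inside  = trans (cong (∣ X ∩ ∁ Y ∣ +_) (+-suc _ _)) (+-suc _ _)
    lemma outside outside = trans (cong (∣ X ∩ ∁ Y ∣ +_) (trans (cong (∣ X ∩ Y ∣ +_) (+-suc _ _)) (+-suc _ _))) (+-suc _ _)

nth : {A : Set} → List A → A → ℕ → A
nth []       d _       = d
nth (x ∷ xs) d zero    = x
nth (x ∷ xs) d (suc t) = nth xs d t

nth-++-∈ : {A : Set} (xs ys : List A) (d : A) {t : ℕ} → t < length xs → nth (xs ++ ys) d t ∈ₗ xs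
nth-++-∈ (x ∷ xs) ys d {zero}  _         = here refl
nth-++-∈ (x ∷ xs) ys d {suc t} (s≤s t<n) = there (nth-++-∈ xs ys d t<n)

nth-++ʳ : {A : Set} (xs ys : List A) (d : A) (t : ℕ) → nth (xs ++ ys) d (length xs + t) ≡ nth ys d t
nth-++ʳ []       ys d t = refl
nth-++ʳ (x ∷ xs) ys d t = nth-++ʳ xs ys d t

∈⇒nth : {A : Set} {x : A} (xs : List A) (d : A) → x ∈ₗ xs → ∃ λ t → t < length xs × nth xs d t ≡ x
∈⇒nth (y ∷ xs) d (here refl) = 0 , s≤s z≤n , refl
∈⇒nth (y ∷ xs) d (there x∈) with ∈⇒nth xs d x∈
... | t , t<n , nth≡x = suc t , s≤s t<n , nth≡x

InRange : ℕ → ℕ → ℕ → Set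
InRange q s v = s ≤ v × v < s + q

window : (ℕ → Fin p) → ℕ → ℕ → Subset p
window e q s = fromList (applyUpTo (λ i → e (s + i)) q)

∣window∣≤ : (e : ℕ → Fin p) (q s : ℕ) → ∣ window e q s ∣ ≤ q
∣window∣≤ e q s = ≤-trans (∣fromList∣≤length (applyUpTo (λ i → e (s + i)) q))
                          (≤-reflexive (length-applyUpTo (λ i → e (s + i)) q))

window-⊆ : (e : ℕ → Fin p) {q s : ℕ} {X : Subset p} → (∀ {i} → i < q → e (s + i) ∈ X) → window e q s ⊆ X
window-⊆ e {q} {s} inX x∈ with ∈-applyUpTo⁻ (λ i → e (s + i)) (∈-fromList⁻ _ x∈)
... | i , i<q , refl = inX i<q

∈-window : (e : ℕ → Fin p) {q s v : ℕ} → InRange q s v → e v ∈ window e q s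
∈-window e {q} {s} {v} (s≤v , v<s+q) =
  subst (λ u → e u ∈ window e q s) (m+[n∸m]≡n s≤v)
        (∈-fromList⁺ (∈-applyUpTo⁺ (λ i → e (s + i)) (+-cancelˡ-< s (v ∸ s) q
          (subst (_< s + q) (sym (m+[n∸m]≡n s≤v)) v<s+q))))

module Residues (c : ℕ) .{{_ : NonZero c}} where

  residue-in-range : ∀ s {t} → t < c → ∃ λ v → s ≤ v × v < s + c × v % c ≡ t
  residue-in-range zero    t<c = _ , z≤n , t<c , m<n⇒m%n≡m t<c
  residue-in-range (suc s) t<c with residue-in-range s t<c
  ... | v , s≤v , v<s+c , v%c≡t with s ≟ v
  ...   | no  s≢v  = v , ≤∧≢⇒< s≤v s≢v , m<n⇒m<1+n v<s+c , v%c≡t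
  ...   | yes refl = s + c , m<m+n s (>-nonZero⁻¹ c) , n<1+n (s + c) , trans ([m+n]%n≡m%n s c) v%c≡t

  three-ranges-hit-residue : ∀ q {s₀ s₁ s₂ t} → s₁ ≤ s₀ + q → s₂ ≤ s₁ + q → s₀ + c ≤ s₂ + q → t < c →
    ∃ λ v → v % c ≡ t × (InRange q s₀ v ⊎ InRange q s₁ v ⊎ InRange q s₂ v)
  three-ranges-hit-residue q {s₀} {s₁} {s₂} s₁≤ s₂≤ s₀+c≤ t<c with residue-in-range s₀ t<c
  ... | v , s₀≤v , v<s₀+c , v%c≡t with v <? s₁ | v <? s₂
  ...   | yes v<s₁ | _        = v , v%c≡t , inj₁ (s₀≤v , ≤-trans v<s₁ s₁≤)
  ...   | no  v≮s₁ | yes v<s₂ = v , v%c≡t , inj₂ (inj₁ (≮⇒≥ v≮s₁ , ≤-trans v<s₂ s₂≤))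
  ...   | no  _    | no  v≮s₂ = v , v%c≡t , inj₂ (inj₂ (≮⇒≥ v≮s₂ , ≤-trans v<s₀+c s₀+c≤))

module EvenlySpaced (N T : ℕ) .{{_ : NonZero N}} where

  mark : ℕ → ℕ
  mark j = j * T / N

  mark-0 : mark 0 ≡ 0
  mark-0 = 0/n≡0 N

  mark-N : mark N ≡ T
  mark-N = trans (cong (_/ N) (*-comm N T)) (m*n/n≡m T N)

  private
    /-shift : ∀ a m → (a + m * N) / N ≡ a / N + m
    /-shift a m = trans (+-distrib-/-∣ʳ a (divides m refl)) (cong (a / N +_) (m*n/n≡m m N))

  mark-step≤ : ∀ d m j → d * T ≤ m * N → mark (d + j) ≤ mark j + m
  mark-step≤ d m j dT≤mN = begin
    (d + j) * T / N       ≡⟨ cong (_/ N) (trans (*-distribʳ-+ T d j) (+-comm (d * T) (j * T))) ⟩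
    (j * T + d * T) / N   ≤⟨ /-monoˡ-≤ N (+-monoʳ-≤ (j * T) dT≤mN) ⟩
    (j * T + m * N) / N   ≡⟨ /-shift (j * T) m ⟩
    mark j + m            ∎
    where open ≤-Reasoning

  mark-step≥ : ∀ d m j → m * N ≤ d * T → mark j + m ≤ mark (d + j)
  mark-step≥ d m j mN≤dT = begin
    mark j + m            ≡⟨ /-shift (j * T) m ⟨
    (j * T + m * N) / N   ≤⟨ /-monoˡ-≤ N (+-monoʳ-≤ (j * T) mN≤dT) ⟩
    (j * T + d * T) / N   ≡⟨ cong (_/ N) (trans (+-comm (j * T) (d * T)) (sym (*-distribʳ-+ T d j))) ⟩
    (d + j) * T / N       ∎
    where open ≤-Reasoning

FitsPath : ℕ → ℕ → ℕ → Set
FitsPath k p q = k * p ≤ (3 * k ∸ 1) * q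

3[1+m]∸1≡3m+2 : ∀ m → 3 * suc m ∸ 1 ≡ 3 * m + 2
3[1+m]∸1≡3m+2 m = unfolded m
  where
  unfolded : ∀ m → m + (suc m + (suc m + 0)) ≡ 3 * m + 2
  unfolded = solve-∀

k≤3k∸1 : ∀ {k} → 1 ≤ k → k ≤ 3 * k ∸ 1
k≤3k∸1 {suc m} _ = begin
  suc m            ≤⟨ n≤1+n (suc m) ⟩
  2 + m            ≡⟨ +-comm 2 m ⟩
  m + 2            ≤⟨ +-monoˡ-≤ 2 (m≤n*m m 3) ⟩
  3 * m + 2        ≡⟨ 3[1+m]∸1≡3m+2 m ⟨
  3 * suc m ∸ 1    ∎
  where open ≤-Reasoning

full-sweep-bounds : ∀ m {c q b} → b ≤ q → FitsPath (suc m) c q →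
                    suc m * c + b ≤ q * (suc m * 3) × (c ∸ q) * (suc m * 3) ≤ 2 * (suc m * c + b)
full-sweep-bounds m {c} {q} {b} b≤q H = upper , lower
  where
  upper : suc m * c + b ≤ q * (suc m * 3)
  upper = begin
    suc m * c + b                  ≤⟨ +-mono-≤ H b≤q ⟩
    (3 * suc m ∸ 1) * q + q        ≡⟨ cong (λ t → t * q + q) (3[1+m]∸1≡3m+2 m) ⟩
    (3 * m + 2) * q + q            ≡⟨ solve (m ∷ q ∷ []) ⟩
    q * (suc m * 3)                ∎
    where open ≤-Reasoning
  [1+m]c≤q[3+3m] : suc m * c ≤ q * (suc m * 3)
  [1+m]c≤q[3+3m] = begin
    suc m * c                      ≤⟨ H ⟩
    (3 * suc m ∸ 1) * q            ≤⟨ *-monoˡ-≤ q (m∸n≤m (3 * suc m) 1) ⟩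
    3 * suc m * q                  ≡⟨ solve (m ∷ q ∷ []) ⟩
    q * (suc m * 3)                ∎
    where open ≤-Reasoning
  lower : (c ∸ q) * (suc m * 3) ≤ 2 * (suc m * c + b)
  lower = begin
    (c ∸ q) * (suc m * 3)                    ≡⟨ *-distribʳ-∸ (suc m * 3) c q ⟩
    c * (suc m * 3) ∸ q * (suc m * 3)        ≤⟨ ∸-monoʳ-≤ (c * (suc m * 3)) [1+m]c≤q[3+3m] ⟩
    c * (suc m * 3) ∸ suc m * c              ≡⟨ cong (_∸ suc m * c) (solve (m ∷ c ∷ [])) ⟩
    2 * (suc m * c) + suc m * c ∸ suc m * c  ≡⟨ m+n∸n≡m (2 * (suc m * c)) (suc m * c) ⟩
    2 * (suc m * c)                          ≤⟨ *-monoʳ-≤ 2 (m≤m+n (suc m * c) b) ⟩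
    2 * (suc m * c + b)                      ∎
    where open ≤-Reasoning

interleaved-bounds-from-key : ∀ m {q b y} → b ≤ q → suc m * (b + y) ≤ m * q + b →
  m * (q + (b + y)) + b ≤ q * suc (m * 2) × (b + y) * suc (m * 2) ≤ m * (q + (b + y)) + b
interleaved-bounds-from-key m {q} {b} {y} b≤q key = upper , lower
  where
  m[b+y]≤mq : m * (b + y) ≤ m * q
  m[b+y]≤mq = +-cancelʳ-≤ b (m * (b + y)) (m * q) (begin
    m * (b + y) + b            ≤⟨ +-monoʳ-≤ (m * (b + y)) (m≤m+n b y) ⟩
    m * (b + y) + (b + y)      ≡⟨ solve (m ∷ b ∷ y ∷ []) ⟩
    suc m * (b + y)            ≤⟨ key ⟩
    m * q + b                  ∎)
    where open ≤-Reasoning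
  upper : m * (q + (b + y)) + b ≤ q * suc (m * 2)
  upper = begin
    m * (q + (b + y)) + b      ≡⟨ solve (m ∷ q ∷ b ∷ y ∷ []) ⟩
    m * q + m * (b + y) + b    ≤⟨ +-mono-≤ (+-monoʳ-≤ (m * q) m[b+y]≤mq) b≤q ⟩
    m * q + m * q + q          ≡⟨ solve (m ∷ q ∷ []) ⟩
    q * suc (m * 2)            ∎
    where open ≤-Reasoning
  lower : (b + y) * suc (m * 2) ≤ m * (q + (b + y)) + b
  lower = begin
    (b + y) * suc (m * 2)      ≡⟨ solve (m ∷ b ∷ y ∷ []) ⟩
    m * (b + y) + suc m * (b + y) ≤⟨ +-monoʳ-≤ (m * (b + y)) key ⟩
    m * (b + y) + (m * q + b)  ≡⟨ solve (m ∷ q ∷ b ∷ y ∷ []) ⟩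
    m * (q + (b + y)) + b      ∎
    where open ≤-Reasoning

interleaved-sweep-key : ∀ m {q b z} → b ≤ q → FitsPath (suc m) (q + (b + z)) q →
                        suc m * (b + (z ∸ q)) ≤ m * q + b
interleaved-sweep-key m {q} {b} {z} b≤q H with z ≤? q
... | yes z≤q = begin
  suc m * (b + (z ∸ q))        ≡⟨ cong (λ y → suc m * (b + y)) (m≤n⇒m∸n≡0 z≤q) ⟩
  suc m * (b + 0)              ≡⟨ solve (m ∷ b ∷ []) ⟩
  m * b + b                    ≤⟨ +-monoˡ-≤ b (*-monoʳ-≤ m b≤q) ⟩
  m * q + b                    ∎
  where open ≤-Reasoning
... | no z≰q with z ∸ q | m+[n∸m]≡n (≰⇒≥ z≰q)
...   | y | refl = ≤-trans (+-cancelʳ-≤ (2 * suc m * q) (suc m * (b + y)) (m * q) (begin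
  suc m * (b + y) + 2 * suc m * q  ≡⟨ solve (m ∷ q ∷ b ∷ y ∷ []) ⟩
  suc m * (q + (b + (q + y)))      ≤⟨ H ⟩
  (3 * suc m ∸ 1) * q              ≡⟨ cong (_* q) (3[1+m]∸1≡3m+2 m) ⟩
  (3 * m + 2) * q                  ≡⟨ solve (m ∷ q ∷ []) ⟩
  m * q + 2 * suc m * q            ∎)) (m≤m+n (m * q) b)
  where open ≤-Reasoning

interleaved-sweep-bounds : ∀ m {q b z} → b ≤ q → FitsPath (suc m) (q + (b + z)) q →
  let c = q + (b + (z ∸ q)) in m * c + b ≤ q * suc (m * 2) × (c ∸ q) * suc (m * 2) ≤ m * c + b
interleaved-sweep-bounds m {q} {b} {z} b≤q H with interleaved-bounds-from-key m b≤q (interleaved-sweep-key m b≤q H)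
... | upper , lower = upper , subst (λ t → t * suc (m * 2) ≤ m * (q + (b + (z ∸ q))) + b) (sym (m+n∸m≡n q (b + (z ∸ q)))) lower

-- M j is the colour set of the path vertex x j.
record PathColouring (p q ℓ : ℕ) (A B : Subset p) : Set where
  field
    M          : ℕ → Subset p
    ∣M∣≤q      : ∀ j → ∣ M j ∣ ≤ q
    M0⊆A       : M 0 ⊆ A
    Mℓ⊆B       : M ℓ ⊆ B
    dominating : ∀ j x → x ∈ M j ⊎ x ∈ M (suc j) ⊎ x ∈ M (suc (suc j))

interleave : Subset p → (ℕ → Subset p) → ℕ → Subset p
interleave W I 0                   = W
interleave W I 1                   = I 0
interleave W I 2                   = I 1
interleave W I (suc (suc (suc j))) = interleave W (λ n → I (suc (suc n))) j

∣interleave∣≤ : ∀ {q} {W : Subset p} {I : ℕ → Subset p} → ∣ W ∣ ≤ q → (∀ n → ∣ I n ∣ ≤ q) → ∀ j → ∣ interleave W I j ∣ ≤ q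
∣interleave∣≤ ∣W∣≤q ∣I∣≤q 0                   = ∣W∣≤q
∣interleave∣≤ ∣W∣≤q ∣I∣≤q 1                   = ∣I∣≤q 0
∣interleave∣≤ ∣W∣≤q ∣I∣≤q 2                   = ∣I∣≤q 1
∣interleave∣≤ ∣W∣≤q ∣I∣≤q (suc (suc (suc j))) = ∣interleave∣≤ ∣W∣≤q (λ n → ∣I∣≤q (suc (suc n))) j

interleave-1+3m : (W : Subset p) (I : ℕ → Subset p) (m : ℕ) → interleave W I (suc (m * 3)) ≡ I (m * 2)
interleave-1+3m W I zero    = refl
interleave-1+3m W I (suc m) = interleave-1+3m W (λ n → I (suc (suc n))) m

interleave-2+3m : (W : Subset p) (I : ℕ → Subset p) (m : ℕ) → interleave W I (suc (suc (m * 3))) ≡ I (suc (m * 2))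
interleave-2+3m W I zero    = refl
interleave-2+3m W I (suc m) = interleave-2+3m W (λ n → I (suc (suc n))) m

interleave-dominating : {W : Subset p} {I : ℕ → Subset p} → (∀ n x → x ∈ W ⊎ x ∈ I n ⊎ x ∈ I (suc n)) →
  ∀ j x → x ∈ interleave W I j ⊎ x ∈ interleave W I (suc j) ⊎ x ∈ interleave W I (suc (suc j))
interleave-dominating W∪I 0 x = W∪I 0 x
interleave-dominating W∪I 1 x with W∪I 0 x
... | inj₁ x∈W               = inj₂ (inj₂ x∈W)
... | inj₂ (inj₁ x∈I₀)       = inj₁ x∈I₀
... | inj₂ (inj₂ x∈I₁)       = inj₂ (inj₁ x∈I₁)
interleave-dominating W∪I 2 x with W∪I 1 x
... | inj₁ x∈W               = inj₂ (inj₁ x∈W)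
... | inj₂ (inj₁ x∈I₁)       = inj₁ x∈I₁
... | inj₂ (inj₂ x∈I₂)       = inj₂ (inj₂ x∈I₂)
interleave-dominating W∪I (suc (suc (suc j))) = interleave-dominating (λ n → W∪I (suc (suc n))) j

data Thirds : ℕ → Set where
  3m+1 : ∀ m → Thirds (suc (m * 3))
  3m+2 : ∀ m → Thirds (suc (suc (m * 3)))
  3m+3 : ∀ m → Thirds (suc m * 3)

thirds : ∀ n → Thirds (suc n)
thirds zero = 3m+1 0
thirds (suc n) with thirds n
... | 3m+1 m = 3m+2 m
... | 3m+2 m = 3m+3 m
... | 3m+3 m = 3m+1 (suc m)

ceil3-thirds : ∀ ℓ r k → r < 3 → 2 + ℓ ≡ r + k * 3 → ceil3 ℓ ≡ k
ceil3-thirds ℓ r k r<3 eq = begin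
  (ℓ + 2) / 3            ≡⟨ cong (_/ 3) (trans (+-comm ℓ 2) eq) ⟩
  (r + k * 3) / 3        ≡⟨ +-distrib-/-∣ʳ r (divides k refl) ⟩
  r / 3 + k * 3 / 3      ≡⟨ cong₂ _+_ (m<n⇒m/n≡0 r<3) (m*n/n≡m k 3) ⟩
  k                      ∎
  where open ≡-Reasoning

module Arrangement {p q : ℕ} (A B : Subset p) (∣A∣≡q : ∣ A ∣ ≡ q) (∣B∣≡q : ∣ B ∣ ≡ q) (0<q : 0 < q) where

  onlyA both onlyB neither : List (Fin p)
  onlyA   = elements (A ∩ ∁ B)
  both    = elements (A ∩ B)
  onlyB   = elements (∁ A ∩ B)
  neither = elements (∁ A ∩ ∁ B)

  a b b′ z : ℕ
  a  = length both
  b  = length onlyA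
  b′ = length onlyB
  z  = length neither

  b+a≡q : b + a ≡ q
  b+a≡q = trans (cong₂ _+_ (length-elements (A ∩ ∁ B)) (length-elements (A ∩ B)))
                (trans (∣p∩∁q∣+∣p∩q∣≡∣p∣ A B) ∣A∣≡q)

  a+b′≡q : a + b′ ≡ q
  a+b′≡q = trans (cong₂ _+_ (length-elements (A ∩ B)) (length-elements (∁ A ∩ B)))
                 (trans (∣p∩q∣+∣∁p∩q∣≡∣q∣ A B) ∣B∣≡q)

  b′≡b : b′ ≡ b
  b′≡b = +-cancelˡ-≡ a b′ b (trans a+b′≡q (trans (sym b+a≡q) (+-comm b a)))

  b+a+b′+z≡p : b + (a + (b′ + z)) ≡ p
  b+a+b′+z≡p = trans (cong₂ _+_ (length-elements (A ∩ ∁ B)) (cong₂ _+_ (length-elements (A ∩ B))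
                       (cong₂ _+_ (length-elements (∁ A ∩ B)) (length-elements (∁ A ∩ ∁ B)))))
                     (∣p∩∁q∣+∣p∩q∣+∣∁p∩q∣+∣∁p∩∁q∣≡n A B)

  q≤p : q ≤ p
  q≤p = subst (_≤ p) ∣A∣≡q (∣p∣≤n A)

  b≤q : b ≤ q
  b≤q = subst (b ≤_) b+a≡q (m≤m+n b a)

  classify : ∀ x → x ∈ₗ onlyA ++ both ++ onlyB ⊎ x ∈ₗ neither
  classify x with x ∈? A | x ∈? B
  ... | yes x∈A | yes x∈B = inj₁ (∈-++⁺ʳ onlyA (∈-++⁺ˡ (∈-elements⁺ _ (x∈p∩q⁺ (x∈A , x∈B)))))
  ... | yes x∈A | no  x∉B = inj₁ (∈-++⁺ˡ (∈-elements⁺ _ (x∈p∩q⁺ (x∈A , x∉p⇒x∈∁p x∉B))))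
  ... | no  x∉A | yes x∈B = inj₁ (∈-++⁺ʳ onlyA (∈-++⁺ʳ both (∈-elements⁺ _ (x∈p∩q⁺ (x∉p⇒x∈∁p x∉A , x∈B)))))
  ... | no  x∉A | no  x∉B = inj₂ (∈-elements⁺ _ (x∈p∩q⁺ (x∉p⇒x∈∁p x∉A , x∉p⇒x∈∁p x∉B)))

  onlyA++both⊆A : ∀ {x} → x ∈ₗ onlyA ++ both → x ∈ A
  onlyA++both⊆A {x} x∈ with ∈-++⁻ onlyA x∈
  ... | inj₁ x∈onlyA = proj₁ (x∈p∩q⁻ A (∁ B) (∈-elements⁻ _ x∈onlyA))
  ... | inj₂ x∈both  = proj₁ (x∈p∩q⁻ A B (∈-elements⁻ _ x∈both))

  both++onlyB⊆B : ∀ {x} → x ∈ₗ both ++ onlyB → x ∈ B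
  both++onlyB⊆B {x} x∈ with ∈-++⁻ both x∈
  ... | inj₁ x∈both  = proj₂ (x∈p∩q⁻ A B (∈-elements⁻ _ x∈both))
  ... | inj₂ x∈onlyB = proj₂ (x∈p∩q⁻ (∁ A) B (∈-elements⁻ _ x∈onlyB))

  default : Fin p
  default = Fin.fromℕ< (≤-trans 0<q q≤p)

  module Sweep (rest : List (Fin p)) where

    arrangement : List (Fin p)
    arrangement = onlyA ++ both ++ onlyB ++ rest

    c : ℕ
    c = length arrangement

    c≡ : c ≡ b + (a + (b′ + length rest))
    c≡ = trans (length-++ onlyA) (cong (b +_) (trans (length-++ both) (cong (a +_) (length-++ onlyB))))

    b+q≤c : b + q ≤ c
    b+q≤c = begin
      b + q                          ≡⟨ cong (b +_) a+b′≡q ⟨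
      b + (a + b′)                   ≤⟨ +-monoʳ-≤ b (+-monoʳ-≤ a (m≤m+n b′ (length rest))) ⟩
      b + (a + (b′ + length rest))   ≡⟨ c≡ ⟨
      c                              ∎
      where open ≤-Reasoning

    q≤c : q ≤ c
    q≤c = ≤-trans (m≤n+m q b) b+q≤c

    instance
      c≢0 : NonZero c
      c≢0 = >-nonZero (≤-trans 0<q q≤c)

    open Residues c

    colour : ℕ → Fin p
    colour v = nth arrangement default (v % c)

    I : ℕ → Subset p
    I = window colour q

    colour-in-A : ∀ {v} → v < q → colour v ∈ A
    colour-in-A {v} v<q = onlyA++both⊆A (subst (_∈ₗ onlyA ++ both) (cong (nth arrangement default) (sym v%c≡v)) prefix)
      where
      v%c≡v : v % c ≡ v
      v%c≡v = m<n⇒m%n≡m (≤-trans v<q q≤c)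
      prefix : nth arrangement default v ∈ₗ onlyA ++ both
      prefix = subst (λ l → nth l default v ∈ₗ onlyA ++ both) (++-assoc onlyA both (onlyB ++ rest))
                 (nth-++-∈ (onlyA ++ both) (onlyB ++ rest) default
                   (subst (v <_) (sym (trans (length-++ onlyA) b+a≡q)) v<q))

    colour-in-B : ∀ j {v} → v < q → colour (j * c + b + v) ∈ B
    colour-in-B j {v} v<q = both++onlyB⊆B (subst (_∈ₗ both ++ onlyB) (cong (nth arrangement default) (sym %c≡)) middle)
      where
      %c≡ : (j * c + b + v) % c ≡ b + v
      %c≡ = trans (cong (_% c) (trans (+-assoc (j * c) b v) (+-comm (j * c) (b + v))))
                  (trans ([m+kn]%n≡m%n (b + v) j c) (m<n⇒m%n≡m (≤-trans (+-monoʳ-< b v<q) b+q≤c)))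
      middle : nth arrangement default (b + v) ∈ₗ both ++ onlyB
      middle = subst (_∈ₗ both ++ onlyB) (sym (nth-++ʳ onlyA (both ++ onlyB ++ rest) default v))
                 (subst (λ l → nth l default v ∈ₗ both ++ onlyB) (++-assoc both onlyB rest)
                   (nth-++-∈ (both ++ onlyB) rest default
                     (subst (v <_) (sym (trans (length-++ both) a+b′≡q)) v<q)))

    I0⊆A : I 0 ⊆ A
    I0⊆A = window-⊆ colour λ i<q → colour-in-A i<q

    I-end⊆B : ∀ j → I (j * c + b) ⊆ B
    I-end⊆B j = window-⊆ colour λ i<q → colour-in-B j i<q

    ∈-arrangement : ∀ {x} → x ∈ₗ onlyA ++ both ++ onlyB ⊎ x ∈ₗ rest → x ∈ₗ arrangement
    ∈-arrangement (inj₁ x∈) = subst (_ ∈ₗ_) (trans (++-assoc onlyA (both ++ onlyB) rest) (cong (onlyA ++_) (++-assoc both onlyB rest)))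
                                (∈-++⁺ˡ x∈)
    ∈-arrangement (inj₂ x∈) = ∈-++⁺ʳ onlyA (∈-++⁺ʳ both (∈-++⁺ʳ onlyB x∈))

    three-windows-cover : ∀ {s₀ s₁ s₂ x} → s₁ ≤ s₀ + q → s₂ ≤ s₁ + q → s₀ + (c ∸ q) ≤ s₂ → x ∈ₗ arrangement →
                          x ∈ I s₀ ⊎ x ∈ I s₁ ⊎ x ∈ I s₂
    three-windows-cover {s₀} {s₁} {s₂} s₁≤ s₂≤ gap x∈ with ∈⇒nth arrangement default x∈
    ... | t , t<c , refl with three-ranges-hit-residue q s₁≤ s₂≤ s₀+c≤s₂+q t<c
      where
      s₀+c≤s₂+q : s₀ + c ≤ s₂ + q
      s₀+c≤s₂+q = begin
        s₀ + c                ≤⟨ +-monoʳ-≤ s₀ (m≤n+m∸n c q) ⟩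
        s₀ + (q + (c ∸ q))    ≡⟨ trans (cong (s₀ +_) (+-comm q (c ∸ q))) (sym (+-assoc s₀ (c ∸ q) q)) ⟩
        s₀ + (c ∸ q) + q      ≤⟨ +-monoˡ-≤ q gap ⟩
        s₂ + q                ∎
        where open ≤-Reasoning
    ...   | v , v%c≡t , in-range = ⊎.map (hit v%c≡t) (⊎.map (hit v%c≡t) (hit v%c≡t)) in-range
      where
      hit : ∀ {s v} → v % c ≡ t → InRange q s v → nth arrangement default t ∈ I s
      hit v%c≡t v∈ = subst (_∈ I _) (cong (nth arrangement default) v%c≡t) (∈-window colour v∈)

    two-windows-cover : ∀ {s₀ s₁ x} → s₁ ≤ s₀ + q → s₀ + (c ∸ q) ≤ s₁ → x ∈ₗ arrangement → x ∈ I s₀ ⊎ x ∈ I s₁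
    two-windows-cover {s₁ = s₁} s₁≤ gap x∈ with three-windows-cover s₁≤ (m≤m+n s₁ q) gap x∈
    ... | inj₁ x∈I₀        = inj₁ x∈I₀
    ... | inj₂ (inj₁ x∈I₁) = inj₂ x∈I₁
    ... | inj₂ (inj₂ x∈I₁) = inj₂ x∈I₁

  regroup : ∀ w → b + (a + (b′ + w)) ≡ q + (b + w)
  regroup w = trans (sym (+-assoc b a (b′ + w))) (cong₂ _+_ b+a≡q (cong (_+ w) b′≡b))

  full-sweep : ∀ m → FitsPath (suc m) p q → PathColouring p q (suc m * 3) A B
  full-sweep m H = record
    { M          = λ j → I (mark j)
    ; ∣M∣≤q      = λ j → ∣window∣≤ colour q (mark j)
    ; M0⊆A       = subst (λ s → I s ⊆ A) (sym mark-0) I0⊆A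
    ; Mℓ⊆B       = subst (λ s → I s ⊆ B) (sym mark-N) (I-end⊆B (suc m))
    ; dominating = λ j x → three-windows-cover (step j) (step (suc j)) (gap j) (∈-arrangement (classify x))
    }
    where
    open Sweep neither
    c≡p : c ≡ p
    c≡p = trans c≡ b+a+b′+z≡p
    open EvenlySpaced (suc m * 3) (suc m * c + b)
    bounds : suc m * c + b ≤ q * (suc m * 3) × (c ∸ q) * (suc m * 3) ≤ 2 * (suc m * c + b)
    bounds = full-sweep-bounds m b≤q (subst (λ c → FitsPath (suc m) c q) (sym c≡p) H)
    step : ∀ j → mark (suc j) ≤ mark j + q
    step j = mark-step≤ 1 q j (subst (_≤ q * (suc m * 3)) (sym (*-identityˡ _)) (proj₁ bounds))
    gap : ∀ j → mark j + (c ∸ q) ≤ mark (suc (suc j))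
    gap j = mark-step≥ 2 (c ∸ q) j (proj₂ bounds)

  module InterleavedSweep (m : ℕ) (H : FitsPath (suc m) p q) where
    open Sweep (drop q neither)
    open EvenlySpaced (suc (m * 2)) (m * c + b)

    W : Subset p
    W = fromList (take q neither)

    ∣W∣≤q : ∣ W ∣ ≤ q
    ∣W∣≤q = ≤-trans (∣fromList∣≤length (take q neither)) (≤-trans (≤-reflexive (length-take q neither)) (m⊓n≤m q z))

    J : ℕ → Subset p
    J n = I (mark n)

    ∣J∣≤q : ∀ n → ∣ J n ∣ ≤ q
    ∣J∣≤q n = ∣window∣≤ colour q (mark n)

    J0⊆A : J 0 ⊆ A
    J0⊆A = subst (λ s → I s ⊆ A) (sym mark-0) I0⊆A

    JN⊆B : J (suc (m * 2)) ⊆ B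
    JN⊆B = subst (λ s → I s ⊆ B) (sym mark-N) (I-end⊆B m)

    bounds : m * c + b ≤ q * suc (m * 2) × (c ∸ q) * suc (m * 2) ≤ m * c + b
    bounds = subst (λ c → m * c + b ≤ q * suc (m * 2) × (c ∸ q) * suc (m * 2) ≤ m * c + b) (sym c≡q+b+y)
                   (interleaved-sweep-bounds m b≤q (subst (λ p → FitsPath (suc m) p q) p≡q+b+z H))
      where
      c≡q+b+y : c ≡ q + (b + (z ∸ q))
      c≡q+b+y = trans c≡ (trans (cong (λ w → b + (a + (b′ + w))) (length-drop q neither)) (regroup (z ∸ q)))
      p≡q+b+z : p ≡ q + (b + z)
      p≡q+b+z = trans (sym b+a+b′+z≡p) (regroup z)

    step : ∀ n → mark (suc n) ≤ mark n + q
    step n = mark-step≤ 1 q n (subst (_≤ q * suc (m * 2)) (sym (*-identityˡ _)) (proj₁ bounds))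

    gap : ∀ n → mark n + (c ∸ q) ≤ mark (suc n)
    gap n = mark-step≥ 1 (c ∸ q) n (subst ((c ∸ q) * suc (m * 2) ≤_) (sym (*-identityˡ _)) (proj₂ bounds))

    W∪J : ∀ n x → x ∈ W ⊎ x ∈ J n ⊎ x ∈ J (suc n)
    W∪J n x with classify x
    ... | inj₁ x∈ = inj₂ (two-windows-cover (step n) (gap n) (∈-arrangement (inj₁ x∈)))
    ... | inj₂ x∈neither with ∈-++⁻ (take q neither) (subst (x ∈ₗ_) (sym (take++drop≡id q neither)) x∈neither)
    ...   | inj₁ x∈take = inj₁ (∈-fromList⁺ x∈take)
    ...   | inj₂ x∈drop = inj₂ (two-windows-cover (step n) (gap n) (∈-arrangement (inj₂ x∈drop)))

  interleaved-sweep-3m+1 : ∀ m → FitsPath (suc m) p q → PathColouring p q (suc (m * 3)) A B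
  interleaved-sweep-3m+1 m H = record
    { M          = λ j → interleave W J (suc j)
    ; ∣M∣≤q      = λ j → ∣interleave∣≤ ∣W∣≤q ∣J∣≤q (suc j)
    ; M0⊆A       = J0⊆A
    ; Mℓ⊆B       = subst (_⊆ B) (sym (interleave-2+3m W J m)) JN⊆B
    ; dominating = λ j → interleave-dominating W∪J (suc j)
    }
    where open InterleavedSweep m H

  interleaved-sweep-3m+2 : ∀ m → FitsPath (suc m) p q → PathColouring p q (suc (suc (m * 3))) A B
  interleaved-sweep-3m+2 m H = record
    { M          = M
    ; ∣M∣≤q      = ∣M∣≤q
    ; M0⊆A       = J0⊆A
    ; Mℓ⊆B       = subst (_⊆ B) (sym (interleave-1+3m W (λ n → J (suc n)) m)) JN⊆B
    ; dominating = dominating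
    }
    where
    open InterleavedSweep m H
    M : ℕ → Subset p
    M zero    = J 0
    M (suc j) = interleave W (λ n → J (suc n)) j
    ∣M∣≤q : ∀ j → ∣ M j ∣ ≤ q
    ∣M∣≤q zero    = ∣J∣≤q 0
    ∣M∣≤q (suc j) = ∣interleave∣≤ ∣W∣≤q (λ n → ∣J∣≤q (suc n)) j
    dominating : ∀ j x → x ∈ M j ⊎ x ∈ M (suc j) ⊎ x ∈ M (suc (suc j))
    dominating zero x with W∪J 0 x
    ... | inj₁ x∈W         = inj₂ (inj₁ x∈W)
    ... | inj₂ (inj₁ x∈J₀) = inj₁ x∈J₀
    ... | inj₂ (inj₂ x∈J₁) = inj₂ (inj₂ x∈J₁)
    dominating (suc j) = interleave-dominating (λ n → W∪J (suc n)) j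

  path-colouring : ∀ ℓ → 1 ≤ ℓ → FitsPath (ceil3 ℓ) p q → PathColouring p q ℓ A B
  path-colouring (suc n) _ fits with thirds n
  ... | 3m+1 m = interleaved-sweep-3m+1 m (subst (λ k → FitsPath k p q) (ceil3-thirds _ 0 (suc m) (s≤s z≤n) refl) fits)
  ... | 3m+2 m = interleaved-sweep-3m+2 m (subst (λ k → FitsPath k p q) (ceil3-thirds _ 1 (suc m) (s≤s (s≤s z≤n)) refl) fits)
  ... | 3m+3 m = full-sweep m (subst (λ k → FitsPath k p q) (ceil3-thirds _ 2 (suc m) ≤-refl refl) fits)

module _ {G : Graph} {ℓ : ℕ} (P : SuspendedPath G ℓ) where

  start-not-inner : ¬ Inner P (x P Fin.zero)
  start-not-inner (i , 0<i , _ , xᵢ≡x₀) with inj P xᵢ≡x₀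
  ... | refl = <-irrefl refl 0<i

  end-not-inner : ¬ Inner P (x P (fromℕ ℓ))
  end-not-inner (i , _ , i<ℓ , xᵢ≡xℓ) with inj P xᵢ≡xℓ
  ... | refl = <-irrefl (toℕ-fromℕ ℓ) i<ℓ

  not-inner⇒endpoint : ∀ i → ¬ Inner P (x P i) → i ≡ Fin.zero ⊎ i ≡ fromℕ ℓ
  not-inner⇒endpoint i not-inner with toℕ i ≟ 0 | toℕ i ≟ ℓ
  ... | yes i≡0 | _       = inj₁ (toℕ-injective i≡0)
  ... | no  _   | yes i≡ℓ = inj₂ (toℕ-injective (trans i≡ℓ (sym (toℕ-fromℕ ℓ))))
  ... | no  i≢0 | no  i≢ℓ = ⊥-elim (not-inner (i , n≢0⇒n>0 i≢0 , ≤∧≢⇒< (toℕ≤pred[n] i) i≢ℓ , refl))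

  inner? : ∀ v → Dec (Inner P v)
  inner? v = any? λ i → (0 <? toℕ i) ×-dec ((toℕ i <? ℓ) ×-dec (x P i Fin.≟ v))

Adj-sym : ∀ (G : Graph) {u v} → Adj G u v → Adj G v u
Adj-sym G {u} {v} = subst T (Graph.sym G u v)

module Extension {G : Graph} {ℓ : ℕ} (P : SuspendedPath G ℓ) {p q : ℕ}
  (col : DomColouringOn G (λ v → ¬ Inner P v) p q)
  (path : PathColouring p q ℓ (DomColouringOn.φ col (x P Fin.zero)) (DomColouringOn.φ col (x P (fromℕ ℓ)))) where

  open DomColouringOn col
  open PathColouring path

  colourBy : ∀ v → Dec (Inner P v) → Subset p
  colourBy v (yes (i , _)) = enlarge (M (toℕ i)) q
  colourBy v (no  _)       = φ v

  ψ : Fin (n G) → Subset p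
  ψ v = colourBy v (inner? P v)

  ∣colourBy∣≡q : ∀ v d → ∣ colourBy v d ∣ ≡ q
  ∣colourBy∣≡q v (yes (i , _)) = ∣enlarge∣≡ (M (toℕ i)) (∣M∣≤q (toℕ i)) q≤p
  ∣colourBy∣≡q v (no  v∉)      = size v v∉

  M⊆colourBy : ∀ i d → M (toℕ i) ⊆ colourBy (x P i) d
  M⊆colourBy i (yes (j , _ , _ , xⱼ≡xᵢ)) with inj P xⱼ≡xᵢ
  ... | refl = ⊆-enlarge (M (toℕ i)) q
  M⊆colourBy i (no not-inner) with not-inner⇒endpoint P i not-inner
  ... | inj₁ refl = M0⊆A
  ... | inj₂ refl = subst (λ j → M j ⊆ φ (x P (fromℕ ℓ))) (sym (toℕ-fromℕ ℓ)) Mℓ⊆B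

  M⊆ψ : ∀ i → M (toℕ i) ⊆ ψ (x P i)
  M⊆ψ i = M⊆colourBy i (inner? P (x P i))

  dominatedBy : ∀ v → Dec (Inner P v) → (c : Fin p) → ∃ λ u → Everything G u × (u ≡ v ⊎ Adj G u v) × c ∈ ψ u
  dominatedBy v (yes (Fin.zero  , () , _)) c
  dominatedBy v (yes (Fin.suc i , _ , 1+i<ℓ , refl)) c with dominating (toℕ i) c
  ... | inj₁ c∈Mᵢ = x P (inject₁ i) , refl , inj₂ (edges P i) , M⊆ψ (inject₁ i) (subst (λ j → c ∈ M j) (sym (toℕ-inject₁ i)) c∈Mᵢ)
  ... | inj₂ (inj₁ c∈Mᵢ₊₁) = x P (Fin.suc i) , refl , inj₁ refl , M⊆ψ (Fin.suc i) c∈Mᵢ₊₁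
  ... | inj₂ (inj₂ c∈Mᵢ₊₂) = x P (Fin.suc j) , refl , inj₂ (Adj-sym G (subst (λ k → Adj G (x P k) (x P (Fin.suc j))) inject₁j≡1+i (edges P j)))
                            , M⊆ψ (Fin.suc j) (subst (λ k → c ∈ M k) (sym (cong suc (toℕ-fromℕ< 1+i<ℓ))) c∈Mᵢ₊₂)
    where
    j : Fin ℓ
    j = fromℕ< 1+i<ℓ
    inject₁j≡1+i : inject₁ j ≡ Fin.suc i
    inject₁j≡1+i = toℕ-injective (trans (toℕ-inject₁ j) (toℕ-fromℕ< 1+i<ℓ))
  dominatedBy v (no not-inner) c with dom v not-inner c
  ... | u , u-not-inner , u~v , c∈φu = u , refl , u~v , subst (c ∈_) (sym (ψ≡φ u u-not-inner)) c∈φu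
    where
    ψ≡φ : ∀ u → ¬ Inner P u → ψ u ≡ φ u
    ψ≡φ u u-not-inner with inner? P u
    ... | yes u-inner = ⊥-elim (u-not-inner u-inner)
    ... | no  _       = refl

  colouring : DomColouringOn G (Everything G) p q
  colouring = record
    { q-pos = q-pos
    ; q≤p   = q≤p
    ; φ     = ψ
    ; size  = λ v _ → ∣colourBy∣≡q v (inner? P v)
    ; dom   = λ v _ → dominatedBy v (inner? P v)
    }

length-concatMap≤ : {A B : Set} (f : A → List B) {k : ℕ} → (∀ a → length (f a) ≤ k) →
                    ∀ xs → length (concatMap f xs) ≤ k * length xs
length-concatMap≤ f     bound []       = z≤n
length-concatMap≤ f {k} bound (a ∷ xs) = begin
  length (f a ++ concatMap f xs)           ≡⟨ length-++ (f a) ⟩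
  length (f a) + length (concatMap f xs)   ≤⟨ +-mono-≤ (bound a) (length-concatMap≤ f bound xs) ⟩
  k + k * length xs                        ≡⟨ *-suc k (length xs) ⟨
  k * suc (length xs)                      ∎
  where open ≤-Reasoning

module ColourReduction {G : Graph} {S : Fin (n G) → Set} {p q : ℕ} (col : DomColouringOn G S p q)
  {k p′ q′ : ℕ} (p′<kp : p′ < k * p) (kq≤q′ : k * q ≤ q′) (q′≤p′ : q′ ≤ p′) (0<q′ : 0 < q′) where

  open DomColouringOn col

  instance
    p≢0 : NonZero p
    p≢0 = >-nonZero (≤-trans q-pos q≤p)

  fold : Fin p′ → Fin p
  fold y = toℕ y mod p

  -- junk value for m ≥ p′
  toFin : ℕ → Fin p′
  toFin m with m <? p′
  ... | yes m<p′ = fromℕ< m<p′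
  ... | no  _    = fromℕ< (≤-trans 0<q′ q′≤p′)

  toFin-toℕ : ∀ y → toFin (toℕ y) ≡ y
  toFin-toℕ y with toℕ y <? p′
  ... | yes y<p′ = toℕ-injective (toℕ-fromℕ< y<p′)
  ... | no  y≮p′ = ⊥-elim (y≮p′ (toℕ<n y))

  -- contains the whole fibre of c under fold, because p′ < k p
  fibre : Fin p → List (Fin p′)
  fibre c = applyUpTo (λ j → toFin (toℕ c + j * p)) k

  ∈-fibre : ∀ y → y ∈ₗ fibre (fold y)
  ∈-fibre y = subst (_∈ₗ fibre (fold y)) unfold (∈-applyUpTo⁺ (λ j → toFin (toℕ (fold y) + j * p)) j<k)
    where
    j : ℕ
    j = toℕ y / p
    j<k : j < k
    j<k = m<n*o⇒m/o<n (<-trans (toℕ<n y) p′<kp)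
    unfold : toFin (toℕ (fold y) + j * p) ≡ y
    unfold = trans (cong (λ r → toFin (r + j * p)) (toℕ-fromℕ< (m%n<n (toℕ y) p)))
                   (trans (cong toFin (sym (m≡m%n+[m/n]*n (toℕ y) p))) (toFin-toℕ y))

  pull : Subset p → Subset p′
  pull X = fromList (concatMap fibre (elements X))

  ∣pull∣≤ : ∀ X → ∣ pull X ∣ ≤ k * ∣ X ∣
  ∣pull∣≤ X = begin
    ∣ pull X ∣                             ≤⟨ ∣fromList∣≤length (concatMap fibre (elements X)) ⟩
    length (concatMap fibre (elements X))  ≤⟨ length-concatMap≤ fibre (λ c → ≤-reflexive (length-applyUpTo _ k)) (elements X) ⟩
    k * length (elements X)                ≡⟨ cong (k *_) (length-elements X) ⟩
    k * ∣ X ∣                              ∎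
    where open ≤-Reasoning

  ∈-pull : ∀ {X y} → fold y ∈ X → y ∈ pull X
  ∈-pull {X} {y} fold-y∈X =
    ∈-fromList⁺ (∈-concatMap⁺ fibre (Any.map (λ { refl → ∈-fibre y }) (∈-elements⁺ X fold-y∈X)))

  colouring : DomColouringOn G S p′ q′
  colouring = record
    { q-pos = 0<q′
    ; q≤p   = q′≤p′
    ; φ     = λ v → enlarge (pull (φ v)) q′
    ; size  = λ v v∈S → ∣enlarge∣≡ (pull (φ v)) (≤-trans (∣pull∣≤ (φ v)) (subst (λ s → k * s ≤ q′) (sym (size v v∈S)) kq≤q′)) q′≤p′
    ; dom   = λ v v∈S y → let u , u∈S , u~v , fold-y∈φu = dom v v∈S (fold y) in
                          u , u∈S , u~v , ⊆-enlarge (pull (φ u)) q′ (∈-pull fold-y∈φu)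
    }

extend-colouring : {G : Graph} {ℓ p q : ℕ} → 1 ≤ ℓ → (P : SuspendedPath G ℓ) →
                   DomColouringOn G (λ v → ¬ Inner P v) p q → FitsPath (ceil3 ℓ) p q →
                   DomColouringOn G (Everything G) p q
extend-colouring {ℓ = ℓ} 1≤ℓ P col fits =
  Extension.colouring P col (path-colouring ℓ 1≤ℓ fits)
  where
  open DomColouringOn col
  open Arrangement (φ (x P Fin.zero)) (φ (x P (fromℕ ℓ))) (size _ (start-not-inner P)) (size _ (end-not-inner P)) q-pos

frac-scale : ∀ a k m → 0 < k → 0 < m → frac a k ≡ frac (a * m) (k * m)
frac-scale a (suc k) (suc m) _ _ =
  ℚ.fromℚᵘ-cong {ℚᵘ.mkℚᵘ (ℤ.+ a) k} {ℚᵘ.mkℚᵘ (ℤ.+ (a * suc m)) (m + k * suc m)} (ℚᵘ.*≡* cross)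
  where
  cross : ℤ.+ a ℤ.* ℤ.+ (suc k * suc m) ≡ ℤ.+ (a * suc m) ℤ.* ℤ.+ (suc k)
  cross = begin
    ℤ.+ a ℤ.* ℤ.+ (suc k * suc m)   ≡⟨ ℤ.pos-* a (suc k * suc m) ⟨
    ℤ.+ (a * (suc k * suc m))       ≡⟨ cong ℤ.+_ (solve (a ∷ k ∷ m ∷ [])) ⟩
    ℤ.+ (a * suc m * suc k)         ≡⟨ ℤ.pos-* (a * suc m) (suc k) ⟩
    ℤ.+ (a * suc m) ℤ.* ℤ.+ (suc k) ∎
    where open ≡-Reasoning

reduce-to-path-ratio : {G : Graph} {S : Fin (n G) → Set} {k p q : ℕ} → 1 ≤ k → ¬ FitsPath k p q →
                       DomColouringOn G S p q → DomColouringOn G S ((3 * k ∸ 1) * q) (k * q)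
reduce-to-path-ratio {k = k} {q = q} 1≤k ¬fits col =
  ColourReduction.colouring col {k = k} (≰⇒> ¬fits) ≤-refl (*-monoˡ-≤ q (k≤3k∸1 1≤k)) (*-mono-≤ 1≤k q-pos)
  where open DomColouringOn col

path-ratio-fits : ∀ k q → FitsPath k ((3 * k ∸ 1) * q) (k * q)
path-ratio-fits k q = ≤-reflexive (begin
  k * ((3 * k ∸ 1) * q)   ≡⟨ *-assoc k (3 * k ∸ 1) q ⟨
  k * (3 * k ∸ 1) * q     ≡⟨ cong (_* q) (*-comm k (3 * k ∸ 1)) ⟩
  (3 * k ∸ 1) * k * q     ≡⟨ *-assoc (3 * k ∸ 1) k q ⟩
  (3 * k ∸ 1) * (k * q)   ∎)
  where open ≡-Reasoning

ceil3-pos : ∀ ℓ → 1 ≤ ℓ → 1 ≤ ceil3 ℓ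
ceil3-pos ℓ 1≤ℓ = m≥n⇒m/n>0 {ℓ + 2} {3} (+-monoˡ-≤ 2 1≤ℓ)

lemma19 : (G : Graph) (ℓ : ℕ) → 1 ≤ ℓ → (P : SuspendedPath G ℓ) →
          (r r′ : ℚ) → IsFdom G r → IsFdomOn G (λ v → ¬ Inner P v) r′ →
          (frac (3 * ceil3 ℓ ∸ 1) (ceil3 ℓ) ⊓ r′) ≤ℚ r
lemma19 G ℓ 1≤ℓ P r r′ fdom fdom′ with IsFdomOn.attained fdom′
... | p , q , col , refl with ceil3 ℓ * p ≤? (3 * ceil3 ℓ ∸ 1) * q
...   | yes fits = begin
  frac (3 * k ∸ 1) k ⊓ frac p q    ≤⟨ ℚ.p⊓q≤q (frac (3 * k ∸ 1) k) (frac p q) ⟩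
  frac p q                         ≤⟨ upper p q (extend-colouring 1≤ℓ P col fits) ⟩
  r                                ∎
  where
  open IsFdomOn fdom
  open ℚ.≤-Reasoning
  k : ℕ
  k = ceil3 ℓ
...   | no ¬fits = begin
  frac (3 * k ∸ 1) k ⊓ frac p q    ≤⟨ ℚ.p⊓q≤p (frac (3 * k ∸ 1) k) (frac p q) ⟩
  frac (3 * k ∸ 1) k               ≡⟨ frac-scale (3 * k ∸ 1) k q (ceil3-pos ℓ 1≤ℓ) (DomColouringOn.q-pos col) ⟩
  frac ((3 * k ∸ 1) * q) (k * q)   ≤⟨ upper _ _ (extend-colouring 1≤ℓ P (reduce-to-path-ratio (ceil3-pos ℓ 1≤ℓ) ¬fits col)
                                                                     (path-ratio-fits k q)) ⟩
  r                                ∎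
  where
  open IsFdomOn fdom
  open ℚ.≤-Reasoning
  k : ℕ
  k = ceil3 ℓ
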